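{- Let $M_1,M_2$ be matroids, $I_1\in\mathcal{I}(M_1)$, $I_2\in\mathcal{I}(M_2)$, $I:=I_1\cup I_2$, $x\in I_1\cup I_2$ and $y\in E(M_1)\cup E(M_2)$. If there exists an $(I_1,I_2,y,x)$-chain, then $(I+y)-x\in\mathcal{I}(M_1\vee M_2)$. Moreover, if in addition $x\in I_1\cap I_2$, then $I+y\in\mathcal{I}(M_1\vee M_2)$.
   Context: Matroids may be infinite (defined by independence axioms (I1) $\emptyset$ independent; (I2) closure under subsets; (I3) whenever $I,I'$ are independent with $I'$ maximal and $I$ not, some $x\in I'\setminus I$ has $I+x$ independent; (IM) for independent $I\subseteq X$, there is a maximal independent set $I'$ with $I\subseteq I'\subseteq X$). $\mathcal{I}(M_1\vee M_2)=\{J_1\cup J_2: J_1\in\mathcal{I}(M_1), J_2\in\mathcal{I}(M_2)\}$. For a set $X$, an $X$-circuit is a circuit containing $X$. A tuple $(y_0=y,y_1,\ldots,y_n=x)$ is an even $(I_1,I_2,y,x)$-chain (of length $n$) if for every even $i<n$ there is a $\{y_i,y_{i+1}\}$-circuit $C_i\subseteq I_1+y_i$ of $M_1$, and for every odd $i<n$ there is a $\{y_i,y_{i+1}\}$-circuit $C_i\subseteq I_2+y_i$ of $M_2$. An odd $(I_1,I_2,y,x)$-chain is defined the same way with the roles of even and odd $i$ interchanged (so even $i$ use $M_2$ and $I_2$, odd $i$ use $M_1$ and $I_1$). An $(I_1,I_2,y,x)$-chain is an even or an odd one; chains of length $0$ (with $y=x$) are allowed. -}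

module Defs where

open import Level using (0ℓ)
open import Data.Product using (Σ; ∃; ∃-syntax; _×_; _,_)
open import Data.Sum using (_⊎_)
open import Relation.Nullary using (¬_)
open import Relation.Binary.PropositionalEquality using (_≡_)
open import Relation.Unary public using (Pred; _⊆_; _∪_; _∩_; ∅; _∈_; _∉_)

Subset : Set → Set₁
Subset A = Pred A 0ℓ

module _ {A : Set} where

  _+ₛ_ : Subset A → A → Subset A
  (X +ₛ y) z = z ∈ X ⊎ z ≡ y

  _-ₛ_ : Subset A → A → Subset A
  (X -ₛ y) z = z ∈ X × ¬ (z ≡ y)

  _≐_ : Subset A → Subset A → Set
  X ≐ Y = (X ⊆ Y) × (Y ⊆ X)

  MaximalIn : (Subset A → Set₁) → Subset A → Subset A → Set₁
  MaximalIn P X J = P J × J ⊆ X × (∀ K → P K → K ⊆ X → J ⊆ K → K ⊆ J)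

-- A (possibly infinite) matroid with ground set E ⊆ A, given by the
-- independence axioms (I1), (I2), (I3), (IM).
record Matroid (A : Set) : Set₂ where
  field
    E       : Subset A
    Indep   : Subset A → Set₁
    indep⊆E : ∀ {I} → Indep I → I ⊆ E
    I1 : Indep ∅
    I2 : ∀ {I J} → Indep J → I ⊆ J → Indep I
    I3 : ∀ {I I'} → Indep I → MaximalIn Indep E I' → ¬ MaximalIn Indep E I →
         ∃[ x ] (x ∈ I' × x ∉ I × Indep (I +ₛ x))
    IM : ∀ {I X} → Indep I → I ⊆ X → X ⊆ E →
         ∃[ I' ] (MaximalIn Indep X I' × I ⊆ I')

module _ {A : Set} (M : Matroid A) where
  open Matroid M

  Dependent : Subset A → Set₁
  Dependent X = X ⊆ E × ¬ Indep X

  Circuit : Subset A → Set₁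
  Circuit C = Dependent C × (∀ D → Dependent D → D ⊆ C → C ⊆ D)

  PairCircuit : A → A → Subset A → Set₁
  PairCircuit a b C = Circuit C × a ∈ C × b ∈ C

-- AltChain M N J K y x  is a tuple (y = y₀, …, yₙ = x)
-- such that step 0 (and every even step) has a {yᵢ,yᵢ₊₁}-circuit of M
-- contained in J + yᵢ, and step 1 (every odd step) has a
-- {yᵢ,yᵢ₊₁}-circuit of N contained in K + yᵢ.
data AltChain {A : Set} (M N : Matroid A) (J K : Subset A) : A → A → Set₂ where
  nil  : ∀ {x} → AltChain M N J K x x
  cons : ∀ {y z x} (C : Subset A) → PairCircuit M y z C → C ⊆ (J +ₛ y) →
         AltChain N M K J z x → AltChain M N J K y x

module _ {A : Set} (M₁ M₂ : Matroid A) (I₁ I₂ : Subset A) where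

  EvenChain OddChain Chain : A → A → Set₂
  EvenChain y x = AltChain M₁ M₂ I₁ I₂ y x
  OddChain  y x = AltChain M₂ M₁ I₂ I₁ y x
  Chain     y x = EvenChain y x ⊎ OddChain y x

IndepUnion : {A : Set} → Matroid A → Matroid A → Subset A → Set₁
IndepUnion M₁ M₂ X =
  ∃[ J₁ ] ∃[ J₂ ] (Matroid.Indep M₁ J₁ × Matroid.Indep M₂ J₂ × X ≐ (J₁ ∪ J₂))

-- Follow a chain y = y₀, y₁, …, yₙ = x backwards.  Step i exchanges yᵢ
-- into the current independent set of its matroid and yᵢ₊₁ out of it,
-- which keeps the set independent because the step's circuit lies in it
-- plus yᵢ.  For this the circuits must not contain elements that a later
-- step has already removed, and the chain must not revisit x; both are
-- arranged by first shortcutting the chain.  After the last step every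
-- element of I + y except x is still covered, and x survives on at least
-- one side.
module Submission where

open import Defs
open import Level using (0ℓ; Lift; lift) renaming (suc to lsuc)
open import Data.Product as Product using (Σ; ∃-syntax; _×_; _,_; proj₁; proj₂)
open import Function using (_∘_; id)
open import Data.Sum as Sum using (_⊎_; inj₁; inj₂)
open import Data.Empty using (⊥-elim)
open import Data.Unit using (⊤; tt)
open import Data.Nat using (ℕ; zero; suc; _<_; s≤s; z≤n)
open import Data.Nat.Properties using (<-trans; n<1+n)
open import Data.Nat.Induction using (<-wellFounded)
open import Induction.WellFounded using (Acc; acc)
open import Relation.Nullary using (¬_; Dec; yes; no)
open import Relation.Binary.PropositionalEquality using (_≡_; _≢_; refl; sym)
open import Relation.Unary using (_≬_)
open import Axiom.ExcludedMiddle using (ExcludedMiddle)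

module _ {A : Set} where

  +ₛ⊆ : ∀ {X Y : Subset A} {a} → X ⊆ Y → a ∈ Y → (X +ₛ a) ⊆ Y
  +ₛ⊆ X⊆Y a∈Y (inj₁ w∈X) = X⊆Y w∈X
  +ₛ⊆ X⊆Y a∈Y (inj₂ refl) = a∈Y

  ∪+ₛ-comm : ∀ {X Y : Subset A} {a} → ((X ∪ Y) +ₛ a) ≐ ((Y ∪ X) +ₛ a)
  ∪+ₛ-comm = Sum.map₁ Sum.swap , Sum.map₁ Sum.swap

  -ₛ-resp-≐ : ∀ {X Y : Subset A} {a} → X ≐ Y → (X -ₛ a) ≐ (Y -ₛ a)
  -ₛ-resp-≐ (X⊆Y , Y⊆X) = Product.map₁ X⊆Y , Product.map₁ Y⊆X

  indepUnion-swap : ∀ {M N : Matroid A} {X} → IndepUnion M N X → IndepUnion N M X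
  indepUnion-swap (J₁ , J₂ , indep₁ , indep₂ , X⊆ , ⊆X) =
    J₂ , J₁ , indep₂ , indep₁ , Sum.swap ∘ X⊆ , ⊆X ∘ Sum.swap

  indepUnion-resp-≐ : ∀ {M N : Matroid A} {X Y} → X ≐ Y → IndepUnion M N X → IndepUnion M N Y
  indepUnion-resp-≐ (X⊆Y , Y⊆X) (J₁ , J₂ , indep₁ , indep₂ , X⊆ , ⊆X) =
    J₁ , J₂ , indep₁ , indep₂ , X⊆ ∘ Y⊆X , X⊆Y ∘ ⊆X

  length : ∀ {M N : Matroid A} {J K y x} → AltChain M N J K y x → ℕ
  length nil            = zero
  length (cons _ _ _ t) = suc (length t)

  -- removed₁ c = {y₁, y₃, …} leaves J and removed₂ c = {y₂, y₄, …} leaves K.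
  removed₁ removed₂ : ∀ {M N : Matroid A} {J K y x} → AltChain M N J K y x → Subset A
  removed₁ nil                    = ∅
  removed₁ (cons {z = z} _ _ _ t) = removed₂ t +ₛ z
  removed₂ nil                    = ∅
  removed₂ (cons _ _ _ t)         = removed₁ t

  suffix₁ : ∀ {M N : Matroid A} {J K y x w} (c : AltChain M N J K y x) → w ∈ removed₁ c →
            Σ (AltChain N M K J w x) λ c′ → length c′ < length c
  suffix₂ : ∀ {M N : Matroid A} {J K y x w} (c : AltChain M N J K y x) → w ∈ removed₂ c →
            Σ (AltChain M N J K w x) λ c′ → length c′ < length c
  suffix₁ (cons _ _ _ t) (inj₂ refl) = t , n<1+n (length t)
  suffix₁ (cons _ _ _ t) (inj₁ w∈R) with suffix₂ t w∈R
  ... | t′ , lt = t′ , <-trans lt (n<1+n (length t))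
  suffix₂ (cons _ _ _ t) w∈R with suffix₁ t w∈R
  ... | t′ , lt = t′ , <-trans lt (n<1+n (length t))

  Reduced : ∀ {M N : Matroid A} {J K y x} → AltChain M N J K y x → Set
  Reduced nil                              = ⊤
  Reduced {y = y} {x = x} (cons C _ _ t)   = y ≢ x × ¬ (C ≬ removed₂ t) × Reduced t

  HeadDistinct : ∀ {M N : Matroid A} {J K y x} → AltChain M N J K y x → Set
  HeadDistinct nil                            = ⊤
  HeadDistinct (cons {y = y} {z = z} _ _ _ _) = y ≢ z

  Normal : ∀ {M N : Matroid A} {J K y x} → AltChain M N J K y x → Set
  Normal c = Reduced c × HeadDistinct c

  NormalChain : (M N : Matroid A) (J K : Subset A) (y x : A) → Set₂
  NormalChain M N J K y x = Σ (AltChain M N J K y x) Normal ⊎ Σ (AltChain N M K J y x) Normal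

  chainLength : ∀ {M N : Matroid A} {J K y x} → Chain M N J K y x → ℕ
  chainLength (inj₁ c) = length c
  chainLength (inj₂ c) = length c

  ShorterChain : ∀ {M N : Matroid A} {J K y x} → AltChain M N J K y x → Set₂
  ShorterChain {M} {N} {J} {K} {y} {x} c = Σ (Chain M N J K y x) λ c′ → chainLength c′ < length c

  reduced-last : ∀ {M N : Matroid A} {J K y x} (c : AltChain M N J K y x) → Reduced c →
                 x ∈ removed₁ c → x ∉ removed₂ c
  reduced-last (cons _ _ _ nil) _ _ ()
  reduced-last (cons _ _ _ (cons _ _ _ _)) (_ , _ , z≢x , _) (inj₂ refl) _ = z≢x refl
  reduced-last (cons _ _ _ t@(cons _ _ _ _)) (_ , _ , rt) (inj₁ x∈R₂) x∈R₁ =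
    reduced-last t rt x∈R₁ x∈R₂

  -- The result of running a chain from y to x; it exchanged only elements
  -- of R out of J and only elements of S out of K.
  record Exchanged (M N : Matroid A) (J K : Subset A) (y x : A) (R S : Subset A) : Set₁ where
    field
      new₁ new₂  : Subset A
      indep₁     : Matroid.Indep M new₁
      indep₂     : Matroid.Indep N new₂
      ⊆-extended : (new₁ ∪ new₂) ⊆ ((J ∪ K) +ₛ y)
      covers     : ∀ {w} → w ∈ ((J ∪ K) +ₛ y) → w ≢ x → w ∈ (new₁ ∪ new₂)
      start∈     : y ≡ x ⊎ y ∈ new₁
      keeps₁     : ∀ {w} → w ∈ J → w ∉ R → w ∈ new₁
      keeps₂     : ∀ {w} → w ∈ K → w ∉ S → w ∈ new₂

  exchanged-nil : ∀ {M N : Matroid A} {J K x} → Matroid.Indep M J → Matroid.Indep N K →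
                  Exchanged M N J K x x ∅ ∅
  exchanged-nil {J = J} {K} iJ iK = record
    { new₁ = J ; new₂ = K ; indep₁ = iJ ; indep₂ = iK
    ; ⊆-extended = inj₁
    ; covers = λ { (inj₁ w∈) _ → w∈ ; (inj₂ refl) w≢x → ⊥-elim (w≢x refl) }
    ; start∈ = inj₁ refl
    ; keeps₁ = λ w∈J _ → w∈J
    ; keeps₂ = λ w∈K _ → w∈K
    }

  -- If yᵢ₊₁ = yᵢ₊₂, the next circuit of M lies in J + yᵢ₊₁ = J, which is independent.
  tail-head-distinct : ∀ {M N : Matroid A} {J K y z x C} → Matroid.Indep M J →
                       PairCircuit M y z C → C ⊆ (J +ₛ y) → y ≢ z →
                       (t : AltChain N M K J z x) → Reduced t → HeadDistinct t
  tail-head-distinct _ _ _ _ nil _ = tt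
  tail-head-distinct _ _ _ _ (cons _ _ _ nil) (z≢x , _) = z≢x
  tail-head-distinct {M = M} {J = J} {z = z} indepJ (_ , _ , z∈C) C⊆J+y y≢z
                     (cons _ _ _ (cons D (circuitD , _) D⊆J+z _)) _ refl =
    proj₂ (proj₁ circuitD) (Matroid.I2 M indepJ (+ₛ⊆ id z∈J ∘ D⊆J+z))
    where
    z∈J : z ∈ J
    z∈J with C⊆J+y z∈C
    ... | inj₁ z∈J′ = z∈J′
    ... | inj₂ z≡y  = ⊥-elim (y≢z (sym z≡y))

module _ (em : ExcludedMiddle (lsuc 0ℓ)) where

  decide : (P : Set) → Dec P
  decide P with em {Lift (lsuc 0ℓ) P}
  ... | yes (lift p) = yes p
  ... | no ¬p        = no λ p → ¬p (lift p)

  module _ {A : Set} (M : Matroid A) where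
    open Matroid M

    IsBase : Subset A → Set₁
    IsBase = MaximalIn Indep E

    circuit-minus-indep : ∀ {C b} → Circuit M C → b ∈ C → Indep (C -ₛ b)
    circuit-minus-indep {C} {b} ((C⊆E , _) , minimal) b∈C with em {Indep (C -ₛ b)}
    ... | yes indep = indep
    ... | no ¬indep = ⊥-elim (proj₂ (minimal (C -ₛ b) ((C⊆E ∘ proj₁) , ¬indep) proj₁ b∈C) refl)

    maximal-above-base : ∀ {B X I} → IsBase B → B ⊆ X → MaximalIn Indep X I → IsBase I
    maximal-above-base {I = I} baseB B⊆X (indepI , I⊆X , maximal) with em {IsBase I}
    ... | yes baseI = baseI
    ... | no ¬baseI with I3 indepI baseB ¬baseI
    ... | x , x∈B , x∉I , indepI+x =
      ⊥-elim (x∉I (maximal (I +ₛ x) indepI+x (+ₛ⊆ I⊆X (B⊆X x∈B)) inj₁ (inj₂ refl)))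

    minus-not-base : ∀ {B b} → IsBase B → b ∈ B → ¬ IsBase (B -ₛ b)
    minus-not-base (indepB , B⊆E , _) b∈B (_ , _ , maximal) =
      proj₂ (maximal _ indepB B⊆E proj₁ b∈B) refl

    base-exchange : ∀ {B B′ b} → IsBase B → IsBase B′ → b ∈ B → b ∉ B′ →
                    ∃[ x ] (x ∈ B′ × x ∉ B × Indep ((B -ₛ b) +ₛ x))
    base-exchange {B} {B′} {b} baseB@(indepB , _) baseB′ b∈B b∉B′
      with I3 (I2 indepB proj₁) baseB′ (minus-not-base baseB b∈B)
    ... | x , x∈B′ , x∉B-b , indep = x , x∈B′ , x∉B , indep
      where
      x∉B : x ∉ B
      x∉B x∈B with decide (x ≡ b)
      ... | yes refl = b∉B′ x∈B′
      ... | no x≢b   = x∉B-b (x∈B , x≢b)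

    -- I is a base, being maximal above B, and the element it gives to B − b
    -- lies in I ∖ B ⊆ {a}.
    base-exchange-extension : ∀ {B I a b} → IsBase B → b ∈ B → MaximalIn Indep (B +ₛ a) I → b ∉ I →
                              Indep ((B -ₛ b) +ₛ a)
    base-exchange-extension baseB b∈B maxI@(_ , I⊆B+a , _) b∉I
      with base-exchange baseB (maximal-above-base baseB inj₁ maxI) b∈B b∉I
    ... | x , x∈I , x∉B , indep with I⊆B+a x∈I
    ...   | inj₁ x∈B = ⊥-elim (x∉B x∈B)
    ...   | inj₂ refl = indep

    circuit-exchange : ∀ {J C a b} → Indep J → Circuit M C → C ⊆ (J +ₛ a) → a ∈ C → b ∈ C →
                       Indep ((J +ₛ a) -ₛ b)
    circuit-exchange {J} {C} {a} {b} indepJ circuit C⊆J+a a∈C b∈C with decide (b ≡ a)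
    ... | yes refl = I2 indepJ λ { (inj₁ w∈J , _) → w∈J ; (inj₂ refl , w≢b) → ⊥-elim (w≢b refl) }
    ... | no b≢a with IM indepJ (indep⊆E indepJ) id
    ... | B , baseB@(_ , B⊆E , _) , J⊆B
      with IM (circuit-minus-indep circuit b∈C) (Sum.map₁ J⊆B ∘ C⊆J+a ∘ proj₁)
              (+ₛ⊆ B⊆E (proj₁ (proj₁ circuit) a∈C))
    ... | I , maxI@(indepI , _) , C-b⊆I =
      I2 (base-exchange-extension baseB (J⊆B b∈J) maxI b∉I)
         λ { (inj₁ w∈J , w≢b) → inj₁ (J⊆B w∈J , w≢b) ; (inj₂ w≡a , _) → inj₂ w≡a }
      where
      b∈J : b ∈ J
      b∈J with C⊆J+a b∈C
      ... | inj₁ b∈J′ = b∈J′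
      ... | inj₂ b≡a  = ⊥-elim (b≢a b≡a)
      b∉I : b ∉ I
      b∉I b∈I = proj₂ (proj₁ circuit) (I2 indepI C⊆I)
        where
        C⊆I : C ⊆ I
        C⊆I {w} w∈C with decide (w ≡ b)
        ... | yes refl = b∈I
        ... | no w≢b   = C-b⊆I (w∈C , w≢b)

  reduced-or-shorter : ∀ {A} {M N : Matroid A} {J K y x} (c : AltChain M N J K y x) →
                       Reduced c ⊎ Σ (AltChain M N J K y x) λ c′ → length c′ < length c
  reduced-or-shorter nil = inj₁ tt
  reduced-or-shorter {y = y} {x} (cons C pc@(circuit , y∈C , _) C⊆J+y t) with decide (y ≡ x)
  ... | yes refl = inj₂ (nil , s≤s z≤n)
  ... | no y≢x with decide (C ≬ removed₂ t)
  ... | yes (w , w∈C , w∈R) =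
    let t′ , lt = suffix₂ t w∈R in inj₂ (cons C (circuit , y∈C , w∈C) C⊆J+y t′ , s≤s lt)
  ... | no C∦R with reduced-or-shorter t
  ... | inj₁ reduced   = inj₁ (y≢x , C∦R , reduced)
  ... | inj₂ (t′ , lt) = inj₂ (cons C pc C⊆J+y t′ , s≤s lt)

  normal-or-shorter : ∀ {A} {M N : Matroid A} {J K y x} (c : AltChain M N J K y x) →
                      Normal c ⊎ ShorterChain c
  normal-or-shorter nil = inj₁ (tt , tt)
  normal-or-shorter (cons {y = y} {z = z} C pc C⊆J+y t) with decide (y ≡ z)
  ... | yes refl = inj₂ (inj₂ t , n<1+n (length t))
  ... | no y≢z with reduced-or-shorter (cons C pc C⊆J+y t)
  ... | inj₁ reduced    = inj₁ (reduced , y≢z)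
  ... | inj₂ (c′ , lt)  = inj₂ (inj₁ c′ , lt)

  normalise-acc : ∀ {A} {M N : Matroid A} {J K y x} (c : AltChain M N J K y x) →
                  Acc _<_ (length c) → NormalChain M N J K y x
  normalise-acc c (acc shorter) with normal-or-shorter c
  ... | inj₁ normal         = inj₁ (c , normal)
  ... | inj₂ (inj₁ c′ , lt) = normalise-acc c′ (shorter lt)
  ... | inj₂ (inj₂ c′ , lt) = Sum.swap (normalise-acc c′ (shorter lt))

  normalise : ∀ {A} {M N : Matroid A} {J K y x} → Chain M N J K y x → NormalChain M N J K y x
  normalise (inj₁ c) = normalise-acc c (<-wellFounded (length c))
  normalise (inj₂ c) = Sum.swap (normalise-acc c (<-wellFounded (length c)))

  exchange-step : ∀ {A} {M N : Matroid A} {J K R S : Subset A} {y z x C} →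
                  Exchanged N M K J z x S R → PairCircuit M y z C → C ⊆ (J +ₛ y) →
                  ¬ (C ≬ R) → y ≢ z → Exchanged M N J K y x (R +ₛ z) S
  exchange-step {A} {M} {J = J} {K} {y = y} {z} {x} {C} e (circuit , y∈C , z∈C) C⊆J+y C∦R y≢z =
    record
      { new₁ = new₁ ; new₂ = E.new₁
      ; indep₁ = circuit-exchange M E.indep₂ circuit C⊆new+y y∈C z∈C
      ; indep₂ = E.indep₁
      ; ⊆-extended = Sum.[ new₁⊆ , shift ∘ E.⊆-extended ∘ inj₁ ]′
      ; covers = covers
      ; start∈ = inj₂ (inj₂ refl , y≢z)
      ; keeps₁ = λ w∈J w∉R+z → inj₁ (E.keeps₂ w∈J (w∉R+z ∘ inj₁)) , (w∉R+z ∘ inj₂)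
      ; keeps₂ = E.keeps₁
      }
    where
    module E = Exchanged e
    new₁ : Subset A
    new₁ = (E.new₂ +ₛ y) -ₛ z

    C⊆new+y : C ⊆ (E.new₂ +ₛ y)
    C⊆new+y w∈C = Sum.map₁ (λ w∈J → E.keeps₂ w∈J λ w∈R → C∦R (_ , w∈C , w∈R)) (C⊆J+y w∈C)

    shift : ∀ {w} → w ∈ ((K ∪ J) +ₛ z) → w ∈ ((J ∪ K) +ₛ y)
    shift (inj₁ w∈K∪J) = inj₁ (Sum.swap w∈K∪J)
    shift (inj₂ refl)  = Sum.map₁ inj₁ (C⊆J+y z∈C)

    new₁⊆ : new₁ ⊆ ((J ∪ K) +ₛ y)
    new₁⊆ (inj₁ w∈new , _) = shift (E.⊆-extended (inj₂ w∈new))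
    new₁⊆ (inj₂ w≡y , _)   = inj₂ w≡y

    covers : ∀ {w} → w ∈ ((J ∪ K) +ₛ y) → w ≢ x → w ∈ (new₁ ∪ E.new₁)
    covers (inj₂ refl) _ = inj₁ (inj₂ refl , y≢z)
    covers {w} (inj₁ w∈J∪K) w≢x with E.covers (inj₁ (Sum.swap w∈J∪K)) w≢x
    ... | inj₁ w∈new = inj₂ w∈new
    ... | inj₂ w∈new with decide (w ≡ z)
    ...   | no w≢z  = inj₁ (inj₁ w∈new , w≢z)
    ...   | yes refl with E.start∈
    ...     | inj₁ z≡x   = ⊥-elim (w≢x z≡x)
    ...     | inj₂ z∈new = inj₂ z∈new

  exchange-along : ∀ {A} {M N : Matroid A} {J K y x} (c : AltChain M N J K y x) →
                   Matroid.Indep M J → Matroid.Indep N K → Normal c →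
                   Exchanged M N J K y x (removed₁ c) (removed₂ c)
  exchange-along nil indepJ indepK _ = exchanged-nil indepJ indepK
  exchange-along (cons C pc C⊆J+y t) indepJ indepK ((_ , C∦R , reduced) , y≢z) =
    exchange-step (exchange-along t indepK indepJ (reduced , head-distinct)) pc C⊆J+y C∦R y≢z
    where
    head-distinct : HeadDistinct t
    head-distinct = tail-head-distinct indepJ pc C⊆J+y y≢z t reduced

  UnionExchange : ∀ {A} → Matroid A → Matroid A → Subset A → Subset A → A → A → Set₁
  UnionExchange M N J K y x =
    IndepUnion M N (((J ∪ K) +ₛ y) -ₛ x) × (x ∈ (J ∩ K) → IndepUnion M N ((J ∪ K) +ₛ y))

  exchanged-unionExchange : ∀ {A} {M N : Matroid A} {J K R S y x} →
                            Exchanged M N J K y x R S → (x ∈ R → x ∉ S) → UnionExchange M N J K y x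
  exchanged-unionExchange {M = M} {N} {J} {K} {R} {y = y} {x} e x∈R→x∉S =
    ( (E.new₁ -ₛ x) , (E.new₂ -ₛ x) , I2 M E.indep₁ proj₁ , I2 N E.indep₂ proj₁
    , (λ { (w∈ , w≢x) → Sum.map (_, w≢x) (_, w≢x) (E.covers w∈ w≢x) })
    , Sum.[ (λ { (w∈ , w≢x) → E.⊆-extended (inj₁ w∈) , w≢x })
          , (λ { (w∈ , w≢x) → E.⊆-extended (inj₂ w∈) , w≢x }) ]′ )
    , λ x∈J∩K → E.new₁ , E.new₂ , E.indep₁ , E.indep₂ , covers x∈J∩K , E.⊆-extended
    where
    module E = Exchanged e
    open Matroid using (I2)
    covers : x ∈ (J ∩ K) → ((J ∪ K) +ₛ y) ⊆ (E.new₁ ∪ E.new₂)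
    covers (x∈J , x∈K) {w} w∈ with decide (w ≡ x) | decide (x ∈ R)
    ... | no w≢x  | _        = E.covers w∈ w≢x
    ... | yes refl | no x∉R  = inj₁ (E.keeps₁ x∈J x∉R)
    ... | yes refl | yes x∈R = inj₂ (E.keeps₂ x∈K (x∈R→x∉S x∈R))

  unionExchange-swap : ∀ {A} {M N : Matroid A} {J K y x} →
                       UnionExchange N M K J y x → UnionExchange M N J K y x
  unionExchange-swap {M = M} {N} (minus , plus) =
    swap (-ₛ-resp-≐ ∪+ₛ-comm) minus , λ { (x∈J , x∈K) → swap ∪+ₛ-comm (plus (x∈K , x∈J)) }
    where
    swap : ∀ {X Y} → X ≐ Y → IndepUnion N M X → IndepUnion M N Y
    swap X≐Y = indepUnion-swap {M = N} {M} ∘ indepUnion-resp-≐ {M = N} {M} X≐Y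

  normal-unionExchange : ∀ {A} {M N : Matroid A} {J K y x} → NormalChain M N J K y x →
                         Matroid.Indep M J → Matroid.Indep N K → UnionExchange M N J K y x
  normal-unionExchange (inj₁ (c , normal)) indepJ indepK =
    exchanged-unionExchange (exchange-along c indepJ indepK normal) (reduced-last c (proj₁ normal))
  normal-unionExchange {M = M} {N} (inj₂ (c , normal)) indepJ indepK =
    unionExchange-swap {M = M} {N}
      (exchanged-unionExchange (exchange-along c indepK indepJ normal) (reduced-last c (proj₁ normal)))

lemma4p5 : ExcludedMiddle (lsuc 0ℓ) →
    {A : Set} (M₁ M₂ : Matroid A) (I₁ I₂ : Subset A) →
    Matroid.Indep M₁ I₁ → Matroid.Indep M₂ I₂ →
    (x y : A) → x ∈ (I₁ ∪ I₂) → y ∈ (Matroid.E M₁ ∪ Matroid.E M₂) →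
    Chain M₁ M₂ I₁ I₂ y x →
    IndepUnion M₁ M₂ (((I₁ ∪ I₂) +ₛ y) -ₛ x)
      × (x ∈ (I₁ ∩ I₂) → IndepUnion M₁ M₂ ((I₁ ∪ I₂) +ₛ y))
lemma4p5 em M₁ M₂ I₁ I₂ indep₁ indep₂ x y _ _ chain =
  normal-unionExchange em (normalise em chain) indep₁ indep₂
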